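{- Let $m,n\in\mathbb N$ with $m\ge 4$ even. Then the graph $C_{m,(n)}$ admits a uniformly ordered labeling.
   Context: $\mathbb N=\{0,1,2,\dots\}$; for integers $a\le b$, $[a,b]=\{x\in\mathbb N: a\le x\le b\}$. For $m\ge 3$ and $n\ge 0$, $C_{m,(n)}$ is the connected graph with $m+n$ vertices and $m+n$ edges consisting of a cycle $C_m$ (on $m$ vertices) and a path $P_{n+1}$ (with $n+1$ vertices and $n$ edges) having exactly one vertex in common, this common vertex being an end vertex of the path (for $n=0$ the graph is just $C_m$). For a graph $G=(V,E)$ with $|E|=m'$ and $t\in\mathbb N$, a labeling is an injective map $f\colon V\to[0,t]$; it induces $\tilde f(\{u,v\})=|f(u)-f(v)|$ on edges. $f$ is a $\overline{\rho}$-labeling if (a) $t\ge 2m'$, (b) $\tilde f$ is injective, (c) there is no $i\in\{1,\dots,m'\}$ with both $i$ and $t+1-i$ in $\operatorname{Im}\tilde f$. If $G$ is bipartite with vertex bipartition $\{A,B\}$, an $(A,B,t)$-uniformly ordered labeling is a $\overline{\rho}$-labeling $f\colon V\to[0,t]$ for which there is $\lambda\in\mathbb N$ with $f(a)\le\lambda$ for all $a\in A$ and $f(b)>\lambda$ for all $b\in B$. A uniformly ordered labeling of a bipartite graph $G$ with $m'$ edges is a labeling $f\colon V\to[0,2m']$ that is $(A,B,2m')$-uniformly ordered for some vertex bipartition $\{A,B\}$ of $G$. -}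

module Defs where

open import Data.Nat.Base using (ℕ; zero; suc; _+_; _*_; _∸_; _≤_; _<_; ∣_-_∣; _<ᵇ_; _≡ᵇ_)
open import Data.Bool.Base using (Bool; true; false; if_then_else_)
open import Data.Product.Base using (_×_; _,_; proj₁; proj₂; Σ; ∃)
open import Relation.Binary.PropositionalEquality using (_≡_)
open import Relation.Nullary using (¬_)

-- A finite (multi)graph: vertices are the naturals v < nV,
-- edges are indexed by the naturals e < nE, edge e joining
-- proj₁ (edge e) and proj₂ (edge e).
record Graph : Set where
  field
    nV   : ℕ
    nE   : ℕ
    edge : ℕ → ℕ × ℕ
open Graph public

-- C_{m,(n)}: cycle on vertices 0,…,m-1 (edges {k,k+1} for k+1<m and {m-1,0}),
-- path 0 — m — m+1 — … — m+n-1 attached at cycle vertex 0.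
-- Edge k (k < m+n):
--   k+1 < m : {k, k+1}
--   k+1 = m : {m-1, 0}
--   k = m   : {0, m}
--   k > m   : {k-1, k}
Cmn : ℕ → ℕ → Graph
Cmn m n = record
  { nV = m + n
  ; nE = m + n
  ; edge = λ k →
      if suc k <ᵇ m then (k , suc k)
      else if suc k ≡ᵇ m then (k , 0)
      else ((if k ≡ᵇ m then 0 else k ∸ 1) , k)
  }

edgeLabel : (G : Graph) → (ℕ → ℕ) → ℕ → ℕ
edgeLabel G f e = ∣ f (proj₁ (edge G e)) - f (proj₂ (edge G e)) ∣

InEdgeImage : (G : Graph) → (ℕ → ℕ) → ℕ → Set
InEdgeImage G f i = Σ ℕ λ e → e < nE G × edgeLabel G f e ≡ i

IsLabeling : (G : Graph) → ℕ → (ℕ → ℕ) → Set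
IsLabeling G t f =
  (∀ v → v < nV G → f v ≤ t) ×
  (∀ u v → u < nV G → v < nV G → f u ≡ f v → u ≡ v)

IsRhoBar : (G : Graph) → ℕ → (ℕ → ℕ) → Set
IsRhoBar G t f =
  IsLabeling G t f ×
  (2 * nE G ≤ t) ×
  (∀ d e → d < nE G → e < nE G → edgeLabel G f d ≡ edgeLabel G f e → d ≡ e) ×
  (∀ i → 1 ≤ i → i ≤ nE G →
     ¬ (InEdgeImage G f i × InEdgeImage G f (suc t ∸ i)))

-- {A,B} is a vertex bipartition: side v = true means v ∈ A, false means v ∈ B;
-- every edge joins A and B.
IsBipartition : (G : Graph) → (ℕ → Bool) → Set
IsBipartition G side =
  ∀ e → e < nE G → ¬ (side (proj₁ (edge G e)) ≡ side (proj₂ (edge G e)))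

IsUniformlyOrdered : (G : Graph) → (ℕ → Bool) → ℕ → (ℕ → ℕ) → Set
IsUniformlyOrdered G side t f =
  IsRhoBar G t f ×
  Σ ℕ λ lam →
    (∀ v → v < nV G → side v ≡ true → f v ≤ lam) ×
    (∀ v → v < nV G → side v ≡ false → lam < f v)

HasUniformlyOrderedLabeling : Graph → Set
HasUniformlyOrderedLabeling G =
  Σ (ℕ → Bool) λ side → IsBipartition G side ×
  Σ (ℕ → ℕ) λ f → IsUniformlyOrdered G side (2 * nE G) f

{-# OPTIONS --safe #-}
-- Number the vertices along the Hamiltonian path 1, 2, …, m−1, 0, m, …, m+n−1; then
-- C_{m,(n)} is a path on the positions 0, …, N−1 (N = m+n) plus the chord {0, m−1}.
-- Write m = 4q+2s with q ≥ 1 and s ∈ {0,1}, and label the positions alternately from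
-- below and from above: position 2j gets low j (0, then s+j) and position 2j+1 gets
-- high j = s+N−j−[j ≥ q]. Every edge then carries the label s+N−ρ for a rank ρ: 0 for the
-- first path edge, s+2q for the chord, and s+p+[p ≥ 2q] for the path edge leaving
-- position p ≥ 1. These ranks are distinct and avoid 1, …, s, so the edge labels are
-- distinct and no two of them are complementary (i and 2N+1−i). Even positions carry
-- labels at most s+⌊(N−1)/2⌋ and odd positions larger ones, so the parity of the
-- position is the bipartition and that bound is λ.
module Submission where

open import Data.Bool.Base using (Bool; true; false; not; if_then_else_)
open import Data.Bool.Properties using (T-≡; ¬-not; not-¬; not-involutive)
open import Data.Nat.Base
open import Data.Nat.Divisibility using (_∣_; divides)
open import Data.Nat.Properties
open import Algebra.Properties.CommutativeSemigroup +-commutativeSemigroup using (interchange)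
open import Data.Product.Base using (_×_; _,_; map; uncurry)
open import Data.Sum.Base using (_⊎_; inj₁; inj₂)
open import Function.Base using (_∘_)
open import Function.Bundles using (Equivalence)
open import Relation.Binary.Definitions using (tri<; tri≈; tri>)
open import Relation.Binary.PropositionalEquality
open import Relation.Nullary using (¬_; yes; no; contradiction)

open import Defs

-- The ℕ analogue of Data.Fin.punchIn: skip c enumerates ℕ ∖ {c} in increasing order.
skip : ℕ → ℕ → ℕ
skip zero    x       = suc x
skip (suc c) zero    = zero
skip (suc c) (suc x) = suc (skip c x)

skip-injective : ∀ c {x y} → skip c x ≡ skip c y → x ≡ y
skip-injective zero    eq = suc-injective eq
skip-injective (suc c) {zero}  {zero}  eq = refl
skip-injective (suc c) {suc x} {suc y} eq = cong suc (skip-injective c (suc-injective eq))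

skip≢ : ∀ c x → skip c x ≢ c
skip≢ (suc c) (suc x) eq = skip≢ c x (suc-injective eq)

x≤skip : ∀ c x → x ≤ skip c x
x≤skip zero    x       = n≤1+n x
x≤skip (suc c) zero    = z≤n
x≤skip (suc c) (suc x) = s≤s (x≤skip c x)

skip≤1+x : ∀ c x → skip c x ≤ suc x
skip≤1+x zero    x       = ≤-refl
skip≤1+x (suc c) zero    = z≤n
skip≤1+x (suc c) (suc x) = s≤s (skip≤1+x c x)

skip-above : ∀ {c x} → c ≤ x → skip c x ≡ suc x
skip-above {x = x}     z≤n       = refl
skip-above {x = suc x} (s≤s c≤x) = cong suc (skip-above c≤x)

skip-*2 : ∀ c j → j + skip c j ≡ skip (c * 2) (j * 2)
skip-*2 zero    zero    = refl
skip-*2 (suc c) zero    = refl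
skip-*2 zero    (suc j) = cong suc (trans (+-suc j (suc j)) (cong suc (skip-*2 zero j)))
skip-*2 (suc c) (suc j) = cong suc (trans (+-suc j (skip c j)) (cong suc (skip-*2 c j)))

skip-*2+1 : ∀ c j → suc j + skip c j ≡ skip (c * 2) (suc (j * 2))
skip-*2+1 zero    j       = cong suc (skip-*2 zero j)
skip-*2+1 (suc c) zero    = refl
skip-*2+1 (suc c) (suc j) = cong (suc ∘ suc) (trans (+-suc j (skip c j)) (skip-*2+1 c j))

data EvenOdd : ℕ → Set where
  even : ∀ j → EvenOdd (j * 2)
  odd  : ∀ j → EvenOdd (suc (j * 2))

evenOdd : ∀ p → EvenOdd p
evenOdd zero = even zero
evenOdd (suc p) with evenOdd p
... | even j = odd j
... | odd j  = even (suc j)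

⌊*2/2⌋ : ∀ j → ⌊ j * 2 /2⌋ ≡ j
⌊*2/2⌋ zero    = refl
⌊*2/2⌋ (suc j) = cong suc (⌊*2/2⌋ j)

interleave : (ℕ → ℕ) → (ℕ → ℕ) → ℕ → ℕ
interleave a b zero          = a zero
interleave a b (suc zero)    = b zero
interleave a b (suc (suc p)) = interleave (a ∘ suc) (b ∘ suc) p

interleave-even : ∀ a b j → interleave a b (j * 2) ≡ a j
interleave-even a b zero    = refl
interleave-even a b (suc j) = interleave-even (a ∘ suc) (b ∘ suc) j

interleave-odd : ∀ a b j → interleave a b (suc (j * 2)) ≡ b j
interleave-odd a b zero    = refl
interleave-odd a b (suc j) = interleave-odd (a ∘ suc) (b ∘ suc) j

isEven : ℕ → Bool
isEven zero    = true
isEven (suc p) = not (isEven p)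

isEven-*2 : ∀ j → isEven (j * 2) ≡ true
isEven-*2 zero    = refl
isEven-*2 (suc j) = trans (not-involutive (isEven (j * 2))) (isEven-*2 j)

isEven-*2+1 : ∀ j → isEven (suc (j * 2)) ≡ false
isEven-*2+1 j = cong not (isEven-*2 j)

<ᵇ-true : ∀ {m n} → m < n → (m <ᵇ n) ≡ true
<ᵇ-true m<n = Equivalence.to T-≡ (<⇒<ᵇ m<n)

<ᵇ-false : ∀ {m n} → n ≤ m → (m <ᵇ n) ≡ false
<ᵇ-false {m} {n} n≤m = ¬-not (λ m<ᵇn → ≤⇒≯ n≤m (<ᵇ⇒< m n (Equivalence.from T-≡ m<ᵇn)))

≡ᵇ-true : ∀ {m n} → m ≡ n → (m ≡ᵇ n) ≡ true
≡ᵇ-true {m} {n} m≡n = Equivalence.to T-≡ (≡⇒≡ᵇ m n m≡n)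

≡ᵇ-false : ∀ {m n} → m ≢ n → (m ≡ᵇ n) ≡ false
≡ᵇ-false {m} {n} m≢n = ¬-not (m≢n ∘ ≡ᵇ⇒≡ m n ∘ Equivalence.from T-≡)

-- Position of a vertex on the Hamiltonian path 1, 2, …, m−1, 0, m, m+1, … of Cmn m n.
pathIndex : ℕ → ℕ → ℕ
pathIndex m zero    = pred m
pathIndex m (suc v) = if suc v <ᵇ m then v else suc v

pathIndex-cycle : ∀ {m v} → suc v < m → pathIndex m (suc v) ≡ v
pathIndex-cycle v<m rewrite <ᵇ-true v<m = refl

pathIndex-tail : ∀ {m v} → m ≤ v → pathIndex m v ≡ v
pathIndex-tail {v = zero}  z≤n = refl
pathIndex-tail {v = suc v} m≤v rewrite <ᵇ-false m≤v = refl

pathEnds : ℕ → ℕ → ℕ → ℕ × ℕ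
pathEnds m n e = map (pathIndex m) (pathIndex m) (edge (Cmn m n) e)

pathEnds-chord : ∀ {m} n → 1 < m → pathEnds m n 0 ≡ (pred m , 0)
pathEnds-chord n 1<m rewrite <ᵇ-true 1<m | pathIndex-cycle 1<m = refl

pathEnds-suc : ∀ m n p → pathEnds m n (suc p) ≡ (p , suc p)
pathEnds-suc m n p with <-cmp (suc p) m
... | tri< p+1<m _ _ with m≤n⇒m<n∨m≡n p+1<m
...   | inj₁ p+2<m
  rewrite <ᵇ-true p+2<m | pathIndex-cycle p+1<m | pathIndex-cycle p+2<m = refl
...   | inj₂ refl
  rewrite <ᵇ-false (≤-refl {suc (suc p)}) | ≡ᵇ-true (refl {x = suc (suc p)})
        | pathIndex-cycle p+1<m = refl
pathEnds-suc m n p | tri≈ _ refl _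
  rewrite <ᵇ-false (n≤1+n (suc p)) | ≡ᵇ-false (1+n≢n {suc p}) | ≡ᵇ-true (refl {x = suc p})
        | pathIndex-tail (≤-refl {suc p}) = refl
pathEnds-suc m n p | tri> _ _ m<p+1
  rewrite <ᵇ-false {suc (suc p)} {m} (m≤n⇒m≤1+n (<⇒≤ m<p+1))
        | ≡ᵇ-false {suc (suc p)} {m} (>⇒≢ (m≤n⇒m≤1+n m<p+1))
        | ≡ᵇ-false {suc p} {m} (>⇒≢ m<p+1)
        | pathIndex-tail {m} {suc p} (<⇒≤ m<p+1) | pathIndex-tail {m} {p} (≤-pred m<p+1) = refl

pathIndex-suc : ∀ m v → (suc v < m × pathIndex m (suc v) ≡ v) ⊎ (m ≤ suc v × pathIndex m (suc v) ≡ suc v)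
pathIndex-suc m v with suc v <? m
... | yes v<m = inj₁ (v<m , pathIndex-cycle v<m)
... | no  v≮m = inj₂ (≮⇒≥ v≮m , pathIndex-tail (≮⇒≥ v≮m))

pred≢pathIndex-suc : ∀ m v → pred m ≢ pathIndex m (suc v)
pred≢pathIndex-suc zero    v ()
pred≢pathIndex-suc (suc m) v eq with pathIndex-suc (suc m) v
... | inj₁ (v<m , e) = <-irrefl (sym (trans eq e)) (≤-pred v<m)
... | inj₂ (m≤v , e) = 1+n≰n (subst (_≤ v) (trans eq e) (≤-pred m≤v))

pathIndex-injective : ∀ m {u v} → pathIndex m u ≡ pathIndex m v → u ≡ v
pathIndex-injective m {zero}  {zero}  _  = refl
pathIndex-injective m {zero}  {suc v} eq = contradiction eq (pred≢pathIndex-suc m v)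
pathIndex-injective m {suc u} {zero}  eq = contradiction (sym eq) (pred≢pathIndex-suc m u)
pathIndex-injective m {suc u} {suc v} eq with pathIndex-suc m u | pathIndex-suc m v
... | inj₁ (_ , eu) | inj₁ (_ , ev) = cong suc (trans (sym eu) (trans eq ev))
... | inj₂ (_ , eu) | inj₂ (_ , ev) = trans (sym eu) (trans eq ev)
... | inj₁ (u<m , eu) | inj₂ (m≤v , ev) =
  contradiction (≤-trans (subst (m ≤_) (sym (trans (sym eu) (trans eq ev))) m≤v) (n≤1+n u)) (<⇒≱ u<m)
... | inj₂ (m≤u , eu) | inj₁ (v<m , ev) =
  contradiction (≤-trans (subst (m ≤_) (trans (sym eu) (trans eq ev)) m≤u) (n≤1+n v)) (<⇒≱ v<m)

pathIndex-< : ∀ {m n v} → 0 < m → v < m + n → pathIndex m v < m + n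
pathIndex-< {suc m} {n} {zero} _ _ = m≤m+n (suc m) n
pathIndex-< {m} {v = suc v} _ v<N with pathIndex-suc m v
... | inj₁ (_ , e) = subst (_< _) (sym e) (<-trans (n<1+n v) v<N)
... | inj₂ (_ , e) = subst (_< _) (sym e) v<N

module _ (G : Graph) (f : ℕ → ℕ) (s : ℕ) (rank : ℕ → ℕ)
         (label+rank : ∀ e → e < nE G → edgeLabel G f e + rank e ≡ s + nE G) where

  edgeLabel-injective : (∀ d e → d < nE G → e < nE G → rank d ≡ rank e → d ≡ e) →
                        ∀ d e → d < nE G → e < nE G → edgeLabel G f d ≡ edgeLabel G f e → d ≡ e
  edgeLabel-injective rank-injective d e d<E e<E eq =
    rank-injective d e d<E e<E (+-cancelˡ-≡ (edgeLabel G f d) _ _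
      (trans (label+rank d d<E) (sym (trans (cong (_+ rank e) eq) (label+rank e e<E)))))

  no-complementary-labels : s ≤ 1 → (∀ e → e < nE G → rank e ≡ 0 ⊎ s < rank e) →
                            ∀ i → i ≤ nE G → ¬ (InEdgeImage G f i × InEdgeImage G f (suc (2 * nE G) ∸ i))
  -- Two labels summing to 2E+1 would have ranks summing to 2s−1.
  no-complementary-labels s≤1 gap i i≤E ((d , d<E , refl) , (e , e<E , eq)) =
    ranks-sum s≤1 (gap d d<E) (gap e e<E) (+-cancelˡ-≡ (E + E) _ _ (begin
      (E + E) + suc (rank d + rank e)   ≡⟨ +-suc (E + E) _ ⟩
      suc (E + E) + (rank d + rank e)   ≡⟨ cong (_+ (rank d + rank e)) labels-sum ⟨
      (Ld + Le) + (rank d + rank e)     ≡⟨ interchange Ld Le (rank d) (rank e) ⟩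
      (Ld + rank d) + (Le + rank e)     ≡⟨ cong₂ _+_ (label+rank d d<E) (label+rank e e<E) ⟩
      (s + E) + (s + E)                 ≡⟨ interchange s E s E ⟩
      (s + s) + (E + E)                 ≡⟨ +-comm (s + s) (E + E) ⟩
      (E + E) + (s + s)                 ∎))
    where
    open ≡-Reasoning
    E = nE G
    Ld = edgeLabel G f d
    Le = edgeLabel G f e
    labels-sum : Ld + Le ≡ suc (E + E)
    labels-sum = begin
      Ld + Le                      ≡⟨ cong (Ld +_) eq ⟩
      Ld + (suc (2 * E) ∸ Ld)      ≡⟨ m+[n∸m]≡n (≤-trans i≤E (≤-trans (m≤m+n E _) (n≤1+n _))) ⟩
      suc (2 * E)                  ≡⟨ cong (suc ∘ (E +_)) (+-identityʳ E) ⟩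
      suc (E + E)                  ∎
    ranks-sum : ∀ {s r r′} → s ≤ 1 → r ≡ 0 ⊎ s < r → r′ ≡ 0 ⊎ s < r′ → suc (r + r′) ≢ s + s
    ranks-sum z≤n       _            _             = λ ()
    ranks-sum (s≤s z≤n) (inj₁ refl) (inj₁ refl)    = λ ()
    ranks-sum (s≤s z≤n) (inj₁ refl) (inj₂ 1<r′) eq = <-irrefl (sym (suc-injective eq)) 1<r′
    ranks-sum (s≤s z≤n) (inj₂ 1<r)  _           eq = <⇒≢ (≤-trans 1<r (m≤m+n _ _)) (sym (suc-injective eq))

∣m-[o∸n]∣+[m+n]≡o : ∀ {m n o} → m + n ≤ o → ∣ m - (o ∸ n) ∣ + (m + n) ≡ o
∣m-[o∸n]∣+[m+n]≡o {m} {n} {o} m+n≤o = begin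
  ∣ m - (o ∸ n) ∣ + (m + n)   ≡⟨ cong (_+ (m + n)) (m≤n⇒∣m-n∣≡n∸m (m+n≤o⇒m≤o∸n m m+n≤o)) ⟩
  (o ∸ n ∸ m) + (m + n)       ≡⟨ cong (_+ (m + n)) (trans (∸-+-assoc o n m) (cong (o ∸_) (+-comm n m))) ⟩
  (o ∸ (m + n)) + (m + n)     ≡⟨ m∸n+n≡m m+n≤o ⟩
  o                           ∎
  where open ≡-Reasoning

module Construction (n r s : ℕ) (s≤1 : s ≤ 1) where

  q k m N T : ℕ
  q = suc r
  k = s + q * 2
  m = k * 2
  N = m + n
  T = s + N

  -- m − 1 = 2c + 1 is the odd position at the far end of the chord.
  c : ℕ
  c = s + suc (r * 2)

  k≡1+c : k ≡ suc c
  k≡1+c = +-suc s (suc (r * 2))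

  pred-m≡ : pred m ≡ suc (c * 2)
  pred-m≡ = cong (pred ∘ (_* 2)) k≡1+c

  1<m : 1 < m
  1<m = subst (1 <_) (cong (_* 2) (sym k≡1+c)) (s≤s (s≤s z≤n))

  m≤N : m ≤ N
  m≤N = m≤m+n m n

  0<N : 0 < N
  0<N = ≤-trans (<⇒≤ 1<m) m≤N

  low high : ℕ → ℕ
  low zero    = zero
  low (suc j) = s + suc j
  high j = T ∸ skip q j

  g : ℕ → ℕ
  g = interleave low high

  g-even : ∀ j → g (j * 2) ≡ low j
  g-even = interleave-even low high

  g-odd : ∀ j → g (suc (j * 2)) ≡ high j
  g-odd = interleave-odd low high

  edgeRank : ℕ → ℕ
  edgeRank zero          = k
  edgeRank (suc zero)    = zero
  edgeRank (suc (suc p)) = s + skip (q * 2) (suc p)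

  chord-rank≢0 : k ≢ 0
  chord-rank≢0 eq = 1+n≢0 (trans (sym k≡1+c) eq)

  chord-rank≢path-rank : ∀ p → k ≢ s + skip (q * 2) (suc p)
  chord-rank≢path-rank p eq = skip≢ (q * 2) (suc p) (sym (+-cancelˡ-≡ s _ _ eq))

  0≢path-rank : ∀ p → 0 ≢ s + skip (q * 2) (suc p)
  0≢path-rank p eq = <⇒≢ (≤-trans (s≤s z≤n) (x≤skip (q * 2) (suc p))) (sym (m+n≡0⇒n≡0 s (sym eq)))

  edgeRank-injective : ∀ {d e} → edgeRank d ≡ edgeRank e → d ≡ e
  edgeRank-injective {zero}        {zero}         _  = refl
  edgeRank-injective {zero}        {suc zero}     eq = contradiction eq chord-rank≢0
  edgeRank-injective {zero}        {suc (suc p)}  eq = contradiction eq (chord-rank≢path-rank p)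
  edgeRank-injective {suc zero}    {zero}         eq = contradiction (sym eq) chord-rank≢0
  edgeRank-injective {suc zero}    {suc zero}     _  = refl
  edgeRank-injective {suc zero}    {suc (suc p)}  eq = contradiction eq (0≢path-rank p)
  edgeRank-injective {suc (suc p)} {zero}         eq = contradiction (sym eq) (chord-rank≢path-rank p)
  edgeRank-injective {suc (suc p)} {suc zero}     eq = contradiction (sym eq) (0≢path-rank p)
  edgeRank-injective {suc (suc p)} {suc (suc p′)} eq =
    cong (suc ∘ suc) (suc-injective (skip-injective (q * 2) (+-cancelˡ-≡ s _ _ eq)))

  edgeRank-gap : ∀ e → edgeRank e ≡ 0 ⊎ s < edgeRank e
  edgeRank-gap zero          = inj₂ (m<m+n s (s≤s z≤n))
  edgeRank-gap (suc zero)    = inj₁ refl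
  edgeRank-gap (suc (suc p)) = inj₂ (m<m+n s (≤-trans (s≤s z≤n) (x≤skip (q * 2) (suc p))))

  edgeRank≤T : ∀ e → e < N → edgeRank e ≤ T
  edgeRank≤T zero          _   = +-monoʳ-≤ s (≤-trans (m≤n+m (q * 2) s) (≤-trans (m≤m*n k 2) m≤N))
  edgeRank≤T (suc zero)    _   = z≤n
  edgeRank≤T (suc (suc p)) e<N = +-monoʳ-≤ s (≤-trans (skip≤1+x (q * 2) (suc p)) (<⇒≤ e<N))

  even-rank : ∀ j → low j + skip q j ≡ edgeRank (suc (j * 2))
  even-rank zero    = refl
  even-rank (suc j) = trans (+-assoc s (suc j) _) (cong (s +_) (skip-*2 q (suc j)))

  odd-rank : ∀ j → low (suc j) + skip q j ≡ edgeRank (suc (suc (j * 2)))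
  odd-rank j = trans (+-assoc s (suc j) _) (cong (s +_) (skip-*2+1 q j))

  chord-rank : low 0 + skip q c ≡ edgeRank 0
  chord-rank = trans (skip-above q≤c) (sym k≡1+c)
    where
    q≤c : q ≤ c
    q≤c = ≤-trans (s≤s (m≤m*n r 2)) (m≤n+m _ s)

  label+rank : ∀ i j {e} → low i + skip q j ≡ edgeRank e → e < N → ∣ low i - high j ∣ + edgeRank e ≡ T
  label+rank i j {e} eq e<N = subst (λ ρ → ∣ low i - high j ∣ + ρ ≡ T) eq
    (∣m-[o∸n]∣+[m+n]≡o {low i} {skip q j} (subst (_≤ T) (sym eq) (edgeRank≤T e e<N)))

  pathEdge-label : ∀ p → suc p < N → ∣ g p - g (suc p) ∣ + edgeRank (suc p) ≡ T
  pathEdge-label p p+1<N with evenOdd p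
  ... | even j rewrite g-even j | g-odd j =
    label+rank j j (even-rank j) p+1<N
  ... | odd j rewrite g-odd j | g-even (suc j) =
    trans (cong (_+ _) (∣-∣-comm (high j) (low (suc j)))) (label+rank (suc j) j (odd-rank j) p+1<N)

  chord-label : ∣ g (pred m) - g 0 ∣ + edgeRank 0 ≡ T
  chord-label rewrite pred-m≡ | g-odd c =
    trans (cong (_+ k) (∣-∣-comm (high c) 0)) (label+rank 0 c chord-rank 0<N)

  f : ℕ → ℕ
  f = g ∘ pathIndex m

  edgeLabel+rank : ∀ e → e < N → edgeLabel (Cmn m n) f e + edgeRank e ≡ T
  edgeLabel+rank zero    _     =
    subst (uncurry λ x y → ∣ g x - g y ∣ + edgeRank 0 ≡ T) (sym (pathEnds-chord n 1<m)) chord-label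
  edgeLabel+rank (suc p) p+1<N =
    subst (uncurry λ x y → ∣ g x - g y ∣ + edgeRank (suc p) ≡ T) (sym (pathEnds-suc m n p))
      (pathEdge-label p p+1<N)

  low≤s+j : ∀ j → low j ≤ s + j
  low≤s+j zero    = z≤n
  low≤s+j (suc j) = ≤-refl

  low-injective : ∀ {i j} → low i ≡ low j → i ≡ j
  low-injective {zero}  {zero}  _  = refl
  low-injective {zero}  {suc j} eq = contradiction (m+n≡0⇒n≡0 s (sym eq)) 1+n≢0
  low-injective {suc i} {zero}  eq = contradiction (m+n≡0⇒n≡0 s eq) 1+n≢0
  low-injective {suc i} {suc j} eq = +-cancelˡ-≡ s _ _ eq

  skip≤T : ∀ j → suc (j * 2) < N → skip q j ≤ T
  skip≤T j lt = ≤-trans (skip≤1+x q j) (≤-trans (s≤s (m≤m*n j 2)) (≤-trans (<⇒≤ lt) (m≤n+m N s)))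

  high-injective : ∀ {i j} → suc (i * 2) < N → suc (j * 2) < N → high i ≡ high j → i ≡ j
  high-injective {i} {j} i<N j<N eq = skip-injective q (∸-cancelˡ-≡ (skip≤T i i<N) (skip≤T j j<N) eq)

  -- ⌊ pred N /2⌋ is the largest index of an even position.
  threshold : ℕ
  threshold = s + ⌊ pred N /2⌋

  low-below : ∀ j → j * 2 < N → low j ≤ threshold
  low-below j lt = ≤-trans (low≤s+j j) (+-monoʳ-≤ s (subst (_≤ _) (⌊*2/2⌋ j) (⌊n/2⌋-mono (<⇒≤pred lt))))

  high-above : ∀ j → suc (j * 2) < N → threshold < high j
  high-above j lt = m+n≤o⇒m≤o∸n (suc threshold) (begin
    suc (s + h) + skip q j          ≤⟨ +-monoʳ-≤ (suc (s + h)) (skip≤1+x q j) ⟩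
    suc (s + h) + suc j             ≡⟨ trans (cong suc (+-assoc s h (suc j))) (sym (+-suc s _)) ⟩
    s + suc (h + suc j)             ≤⟨ +-monoʳ-≤ s (s≤s (+-monoʳ-≤ h 1+j≤h′)) ⟩
    s + suc (h + h′)                ≡⟨ cong (λ x → s + suc x) (⌊n/2⌋+⌈n/2⌉≡n (pred N)) ⟩
    s + suc (pred N)                ≡⟨ cong (s +_) (suc-pred N {{>-nonZero 0<N}}) ⟩
    T                               ∎)
    where
    open ≤-Reasoning
    h = ⌊ pred N /2⌋
    h′ = ⌈ pred N /2⌉
    1+j≤h′ : suc j ≤ h′
    1+j≤h′ = subst (_≤ h′) (cong suc (⌊*2/2⌋ j)) (⌈n/2⌉-mono (<⇒≤pred lt))

  g-injective : ∀ {p p′} → p < N → p′ < N → g p ≡ g p′ → p ≡ p′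
  g-injective {p} {p′} p<N p′<N eq with evenOdd p | evenOdd p′
  ... | even i | even j =
    cong (_* 2) (low-injective {i} {j} (trans (sym (g-even i)) (trans eq (g-even j))))
  ... | odd i  | odd j  =
    cong (suc ∘ (_* 2)) (high-injective {i} {j} p<N p′<N (trans (sym (g-odd i)) (trans eq (g-odd j))))
  ... | even i | odd j  = contradiction (trans (sym (g-even i)) (trans eq (g-odd j)))
                                        (<⇒≢ (≤-<-trans (low-below i p<N) (high-above j p′<N)))
  ... | odd i  | even j = contradiction (trans (sym (g-even j)) (trans (sym eq) (g-odd i)))
                                        (<⇒≢ (≤-<-trans (low-below j p′<N) (high-above i p<N)))

  g≤T : ∀ {p} → p < N → g p ≤ T
  g≤T {p} p<N with evenOdd p
  ... | even j rewrite g-even j = ≤-trans (low≤s+j j) (+-monoʳ-≤ s (≤-trans (m≤m*n j 2) (<⇒≤ p<N)))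
  ... | odd j  rewrite g-odd j  = m∸n≤m T (skip q j)

  even-below : ∀ {p} → p < N → isEven p ≡ true → g p ≤ threshold
  even-below {p} p<N ev with evenOdd p
  ... | even j rewrite g-even j = low-below j p<N
  ... | odd j  = contradiction (trans (sym ev) (isEven-*2+1 j)) λ ()

  odd-above : ∀ {p} → p < N → isEven p ≡ false → threshold < g p
  odd-above {p} p<N od with evenOdd p
  ... | even j = contradiction (trans (sym (isEven-*2 j)) od) λ ()
  ... | odd j  rewrite g-odd j = high-above j p<N

  side : ℕ → Bool
  side = isEven ∘ pathIndex m

  bipartite : IsBipartition (Cmn m n) side
  bipartite zero    _ = subst (uncurry λ x y → isEven x ≢ isEven y) (sym (pathEnds-chord n 1<m)) chord-odd
    where
    chord-odd : isEven (pred m) ≢ true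
    chord-odd rewrite pred-m≡ | isEven-*2+1 c = λ ()
  bipartite (suc p) _ = subst (uncurry λ x y → isEven x ≢ isEven y) (sym (pathEnds-suc m n p)) (not-¬ refl)

  uniformlyOrdered : HasUniformlyOrderedLabeling (Cmn m n)
  uniformlyOrdered =
    side , bipartite , f ,
    ( ( (λ v v<N → ≤-trans (g≤T (pathIndex-< 0<m v<N)) T≤2N)
      , (λ u v u<N v<N eq →
          pathIndex-injective m (g-injective (pathIndex-< 0<m u<N) (pathIndex-< 0<m v<N) eq)) )
    , ≤-refl
    , edgeLabel-injective (Cmn m n) f s edgeRank edgeLabel+rank (λ _ _ _ _ → edgeRank-injective)
    , (λ i _ → no-complementary-labels (Cmn m n) f s edgeRank edgeLabel+rank s≤1
                 (λ e _ → edgeRank-gap e) i) )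
    , threshold
    , (λ v v<N → even-below (pathIndex-< 0<m v<N))
    , (λ v v<N → odd-above (pathIndex-< 0<m v<N))
    where
    0<m : 0 < m
    0<m = <⇒≤ 1<m
    T≤2N : T ≤ 2 * N
    T≤2N = +-mono-≤ (≤-trans s≤1 0<N) (≤-reflexive (sym (+-identityʳ N)))

theorem3 : (m n : ℕ) → 4 ≤ m → 2 ∣ m → HasUniformlyOrderedLabeling (Cmn m n)
theorem3 _ n 4≤m (divides h refl) with evenOdd h | 4≤m
... | even zero    | ()
... | odd  zero    | s≤s (s≤s ())
... | even (suc r) | _ = Construction.uniformlyOrdered n r 0 z≤n
... | odd  (suc r) | _ = Construction.uniformlyOrdered n r 1 ≤-refl
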